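{- Suppose $R$ is a special rim hook tableau of shape $\lambda=(\lambda_1,\lambda_2,\dots,\lambda_\ell)$. Then $\sigma=\operatorname{perm}_{\mathrm{SRT}}(R)$ is a permutation of $[\ell]$.
   Context: For a partition $\lambda=(\lambda_1\ge\dots\ge\lambda_\ell>0)$, its Ferrers diagram is the set of cells $(i,j)$, $1\le i\le\ell$, $1\le j\le\lambda_i$ (row $i$ from the top). A rim hook is a connected skew diagram (difference of two Ferrers diagrams of partitions) containing no $2\times2$ square. A special rim hook tableau (SRT) of shape $\lambda$ is a partition of the diagram of $\lambda$ into rim hooks each containing a cell of the first column. The initial cell of a rim hook is its northeastern-most cell; the terminal cell is its southwestern-most cell (which lies in column 1). The $d$-th diagonal is $\mathcal L_d=\{(d+k,1+k):k\in\mathbb Z\}$. Each diagonal contains at most one initial cell of the rim hooks of an SRT. Definition: $\operatorname{perm}_{\mathrm{SRT}}(R)=\sigma$ is the function on $[\ell]$ given for each $i\in[\ell]$ by: if the diagonal $\mathcal L_{i-\lambda_i+1}$ contains no initial cell, $\sigma_i=i-\lambda_i$; otherwise $\sigma_i$ is the row containing the terminal cell of the rim hook whose initial cell lies in $\mathcal L_{i-\lambda_i+1}$. -}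

module Defs where

open import Data.Nat using (ℕ; zero; suc; _≤_; _≥_; _<_)
open import Data.Integer as ℤ using (ℤ; +_)
open import Data.List using (List; []; _∷_; length; lookup)
open import Data.List.Relation.Unary.All using (All)
open import Data.List.Relation.Unary.Linked using (Linked)
open import Data.List.Membership.Propositional using (_∈_)
open import Data.Fin using (Fin)
open import Data.Product using (Σ; ∃; _×_; _,_; proj₁; proj₂)
open import Data.Sum using (_⊎_)
open import Relation.Nullary using (¬_)
open import Relation.Binary.PropositionalEquality using (_≡_)

IsPartition : List ℕ → Set
IsPartition λs = Linked _≥_ λs × All (λ x → 1 ≤ x) λs

-- λ_i with 1-based index i; 0 outside 1..ℓ.
part : List ℕ → ℕ → ℕ
part λs zero = 0
part [] (suc i) = 0
part (x ∷ xs) (suc zero) = x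
part (x ∷ xs) (suc (suc i)) = part xs (suc i)

-- Cells (row , column), 1-based.
Cell : Set
Cell = ℕ × ℕ

row : Cell → ℕ
row = proj₁

col : Cell → ℕ
col = proj₂

-- Ferrers diagram membership: 1 ≤ i ≤ ℓ and 1 ≤ j ≤ λ_i
-- (i ≤ ℓ is implied by j ≤ λ_i with j ≥ 1).
InDiag : List ℕ → Cell → Set
InDiag λs (i , j) = 1 ≤ i × 1 ≤ j × j ≤ part λs i

_⊆ₚ_ : List ℕ → List ℕ → Set
ν ⊆ₚ μ = ∀ i → part ν i ≤ part μ i

IsSkew : List Cell → Set
IsSkew h = Σ (List ℕ) λ μ → Σ (List ℕ) λ ν →
  IsPartition μ × IsPartition ν × ν ⊆ₚ μ ×
  (∀ c → (c ∈ h → InDiag μ c × ¬ InDiag ν c) × (InDiag μ c → ¬ InDiag ν c → c ∈ h))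

Adj : Cell → Cell → Set
Adj (i , j) (i' , j') =
  (i ≡ i' × (suc j ≡ j' ⊎ j ≡ suc j')) ⊎ (j ≡ j' × (suc i ≡ i' ⊎ i ≡ suc i'))

data Path (h : List Cell) : Cell → Cell → Set where
  here : ∀ {c} → c ∈ h → Path h c c
  step : ∀ {c c' d} → c ∈ h → Adj c c' → Path h c' d → Path h c d

Connected : List Cell → Set
Connected h = ∀ c d → c ∈ h → d ∈ h → Path h c d

NoSquare : List Cell → Set
NoSquare h = ¬ (Σ ℕ λ i → Σ ℕ λ j →
  (i , j) ∈ h × (suc i , j) ∈ h × (i , suc j) ∈ h × (suc i , suc j) ∈ h)

IsRimHook : List Cell → Set
IsRimHook h = IsSkew h × Connected h × NoSquare h

record SRT (λs : List ℕ) : Set where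
  field
    hooks     : List (List Cell)
    rimHook   : ∀ (k : Fin (length hooks)) → IsRimHook (lookup hooks k)
    firstCol  : ∀ (k : Fin (length hooks)) → Σ ℕ λ i → (i , 1) ∈ lookup hooks k
    covers    : ∀ c → InDiag λs c → Σ (Fin (length hooks)) λ k → c ∈ lookup hooks k
    inside    : ∀ (k : Fin (length hooks)) c → c ∈ lookup hooks k → InDiag λs c
    disjoint  : ∀ (k k' : Fin (length hooks)) c →
                c ∈ lookup hooks k → c ∈ lookup hooks k' → k ≡ k'

IsInitial : List Cell → Cell → Set
IsInitial h c = c ∈ h × (∀ d → d ∈ h → row c ≤ row d × col d ≤ col c)

IsTerminal : List Cell → Cell → Set
IsTerminal h c = c ∈ h × (∀ d → d ∈ h → row d ≤ row c × col c ≤ col d)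

-- Cell c lies on diagonal L_d = {(d+k, 1+k)} iff row - col + 1 = d.
OnDiag : ℤ → Cell → Set
OnDiag d (i , j) = (+ i ℤ.- + j) ℤ.+ + 1 ≡ d

-- perm_SRT(R) = σ  (σ given as a function ℕ → ℤ; only values on [ℓ] matter).
IsPermSRT : (λs : List ℕ) → SRT λs → (ℕ → ℤ) → Set
IsPermSRT λs R σ = ∀ i → 1 ≤ i → i ≤ length λs →
  let d = (+ i ℤ.- + part λs i) ℤ.+ + 1 in
  (¬ (Σ (Fin (length hooks)) λ k → Σ Cell λ c → IsInitial (lookup hooks k) c × OnDiag d c)
     × σ i ≡ + i ℤ.- + part λs i)
  ⊎ (Σ (Fin (length hooks)) λ k → Σ Cell λ c → Σ Cell λ t →
       IsInitial (lookup hooks k) c × OnDiag d c ×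
       IsTerminal (lookup hooks k) t × σ i ≡ + row t)
  where open SRT R

IsPermutationOf : ℕ → (ℕ → ℤ) → Set
IsPermutationOf ℓ σ =
  (∀ i → 1 ≤ i → i ≤ ℓ → Σ ℕ λ m → σ i ≡ + m × 1 ≤ m × m ≤ ℓ)
  × (∀ i j → 1 ≤ i → i ≤ ℓ → 1 ≤ j → j ≤ ℓ → σ i ≡ σ j → i ≡ j)
  × (∀ m → 1 ≤ m → m ≤ ℓ → Σ ℕ λ i → 1 ≤ i × i ≤ ℓ × σ i ≡ + m)

{-# OPTIONS --safe #-}
module Submission where

-- Count the cells of λ on a diagonal row − col = d twice, row by row and hook by hook. Row r
-- meets the diagonals r − λᵣ, …, r − 1, and a rim hook, being connected without 2×2 squares,
-- meets each diagonal from that of its initial cell up to (terminal row) − 1 exactly once.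
-- Passing from d − 1 to d, both counts change only at the ends of these intervals, whence
--   [1 ≤ d ≤ ℓ] + #{initial cells on d} = #{i : i − λᵢ = d} + #{hooks with terminal row d}.
-- For d = i − λᵢ the right side is positive, so if no initial cell lies on d, then d is a row
-- index that is no terminal row. Thus σ maps [ℓ] into [ℓ]; it is injective since distinct
-- hooks have distinct terminal rows and i − λᵢ is strictly increasing; and an injective
-- self-map of [ℓ] is a permutation.

open import Defs
open import Data.Empty using (⊥-elim)
open import Data.Fin as Fin using (Fin; toℕ; fromℕ<; punchOut)
open import Data.Fin.Properties as Fin
  using (toℕ<n; toℕ-fromℕ<; toℕ-injective; punchOut-injective; <⇒notInjective)
open import Data.Integer as ℤ using (ℤ; +_)
import Data.Integer.Properties as ℤ
open import Data.Integer.Solver using (module +-*-Solver)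
open import Data.List using (List; []; _∷_; length; lookup)
open import Data.List.Extrema.Nat
  using (argmin; argmax; argmin-all; argmax-all; f[argmin]≤f[xs]; f[xs]≤f[argmax])
open import Data.List.Membership.Propositional using (_∈_; find; lose)
open import Data.List.Relation.Unary.All as All using (All; _∷_)
open import Data.List.Relation.Unary.Any using (Any; any?)
open import Data.List.Relation.Unary.Linked as Linked using (Linked; _∷_)
open import Data.Nat using (ℕ; zero; suc; _+_; _∸_; _≤_; _<_; _≥_; z≤n; s≤s; _≟_; _≤?_)
open import Data.Nat.Properties
open import Data.Product using (Σ; ∃; _×_; _,_; proj₁; proj₂)
open import Data.Sum using (_⊎_; inj₁; inj₂; [_,_])
open import Function using (id; _∘_; case_of_; Injective; _⇔_; mk⇔; Equivalence)
open import Relation.Binary using (tri<; tri≈; tri>)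
open import Relation.Binary.PropositionalEquality
  using (_≡_; _≢_; refl; sym; trans; cong; cong₂; subst; subst₂; module ≡-Reasoning)
open import Relation.Nullary using (¬_; Dec; yes; no; contradiction)
open import Relation.Nullary.Decidable using (_×-dec_)
open import Relation.Unary using (Pred; Decidable)

open import Algebra.Properties.CommutativeMonoid.Sum +-0-commutativeMonoid
  using (sum; ∑-distrib-+; ∑-comm; sum-cong-≗)
open import Algebra.Properties.CommutativeSemigroup +-commutativeSemigroup
  using (interchange; xy∙z≈xz∙y; xy∙z≈x∙zy)
open Equivalence using (to; from)

indicator : {P : Set} → Dec P → ℕ
indicator (yes _) = 1
indicator (no _)  = 0

indicator-⊎ : {P Q R : Set} (P? : Dec P) (Q? : Dec Q) (R? : Dec R) →
              R ⇔ (P ⊎ Q) → ¬ (P × Q) → indicator R? ≡ indicator P? + indicator Q?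
indicator-⊎ (yes p)  (yes q)  _       _   disjoint = contradiction (p , q) disjoint
indicator-⊎ (yes _)  (no _)   (yes _) _   _        = refl
indicator-⊎ (yes p)  (no _)   (no ¬r) R⇔  _        = contradiction (from R⇔ (inj₁ p)) ¬r
indicator-⊎ (no _)   (yes _)  (yes _) _   _        = refl
indicator-⊎ (no _)   (yes q)  (no ¬r) R⇔  _        = contradiction (from R⇔ (inj₂ q)) ¬r
indicator-⊎ (no ¬p)  (no ¬q)  (yes r) R⇔  _        = ⊥-elim ([ ¬p , ¬q ] (to R⇔ r))
indicator-⊎ (no _)   (no _)   (no _)  _   _        = refl

AtMostOne : ∀ {n} → Pred (Fin n) _ → Set
AtMostOne P = ∀ {i j} → P i → P j → i ≡ j

count : ∀ {n} {P : Pred (Fin n) _} → Decidable P → ℕ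
count P? = sum (λ i → indicator (P? i))

count≡0 : ∀ {n} {P : Pred (Fin n) _} (P? : Decidable P) → (∀ i → ¬ P i) → count P? ≡ 0
count≡0 {zero}  P? ¬P = refl
count≡0 {suc n} P? ¬P with P? Fin.zero
... | yes p = contradiction p (¬P Fin.zero)
... | no _  = count≡0 (P? ∘ Fin.suc) (¬P ∘ Fin.suc)

count>0⇒∃ : ∀ {n} {P : Pred (Fin n) _} (P? : Decidable P) → 0 < count P? → ∃ P
count>0⇒∃ {suc n} P? count>0 with P? Fin.zero
... | yes p = Fin.zero , p
... | no _  = let i , p = count>0⇒∃ (P? ∘ Fin.suc) count>0 in Fin.suc i , p

∃⇒count>0 : ∀ {n} {P : Pred (Fin n) _} (P? : Decidable P) {i} → P i → 0 < count P?
∃⇒count>0 P? {Fin.zero} p with P? Fin.zero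
... | yes _ = s≤s z≤n
... | no ¬p = contradiction p ¬p
∃⇒count>0 P? {Fin.suc i} p = ≤-trans (∃⇒count>0 (P? ∘ Fin.suc) p) (m≤n+m _ _)

count≤1 : ∀ {n} {P : Pred (Fin n) _} (P? : Decidable P) → AtMostOne P → count P? ≤ 1
count≤1 {zero}  P? unique = z≤n
count≤1 {suc n} P? unique with P? Fin.zero
... | yes p = ≤-reflexive (cong suc (count≡0 (P? ∘ Fin.suc) (λ i q → case unique p q of λ ())))
... | no _  = count≤1 (P? ∘ Fin.suc) (λ p q → Fin.suc-injective (unique p q))

indicator≡count : ∀ {n} {A : Set} {P : Pred (Fin n) _} (A? : Dec A) (P? : Decidable P) →
                  (A → ∃ P) → (∀ {i} → P i → A) → AtMostOne P → indicator A? ≡ count P?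
indicator≡count (yes a) P? witness _ unique =
  ≤-antisym (∃⇒count>0 P? (proj₂ (witness a))) (count≤1 P? unique)
indicator≡count (no ¬a) P? _ sound _ = sym (count≡0 P? (λ _ p → ¬a (sound p)))

count-matching : ∀ {m n} {A : Pred (Fin m) _} {B : Pred (Fin n) _} {C : Fin m → Fin n → Set}
  (A? : Decidable A) (B? : Decidable B) (C? : ∀ i j → Dec (C i j)) →
  (∀ i → A i → ∃ (C i)) → (∀ {i j} → C i j → A i) → (∀ i → AtMostOne (C i)) →
  (∀ j → B j → ∃ λ i → C i j) → (∀ {i j} → C i j → B j) →
  (∀ j → AtMostOne λ i → C i j) →
  count A? ≡ count B?
count-matching A? B? C? A⇒C C⇒A C-uniqueʳ B⇒C C⇒B C-uniqueˡ = begin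
  sum (λ i → indicator (A? i))
    ≡⟨ sum-cong-≗ (λ i → indicator≡count (A? i) (C? i) (A⇒C i) C⇒A (C-uniqueʳ i)) ⟩
  sum (λ i → sum (λ j → indicator (C? i j)))
    ≡⟨ ∑-comm (λ i j → indicator (C? i j)) ⟩
  sum (λ j → sum (λ i → indicator (C? i j)))
    ≡⟨ sum-cong-≗ (λ j → indicator≡count (B? j) (λ i → C? i j) (B⇒C j) C⇒B (C-uniqueˡ j))
     ⟨
  sum (λ j → indicator (B? j)) ∎
  where open ≡-Reasoning

fin-injective⇒surjective : ∀ {n} {f : Fin n → Fin n} → Injective _≡_ _≡_ f →
                           ∀ y → ∃ λ x → f x ≡ y
fin-injective⇒surjective {suc n} {f} f-injective y with Fin.any? (λ x → f x Fin.≟ y)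
... | yes found  = found
... | no y∉image = ⊥-elim (<⇒notInjective (n<1+n n) punchOut∘f-injective)
  where
  y≢f : ∀ x → y ≢ f x
  y≢f x y≡fx = y∉image (x , sym y≡fx)
  punchOut∘f : Fin (suc n) → Fin n
  punchOut∘f x = punchOut (y≢f x)
  punchOut∘f-injective : Injective _≡_ _≡_ punchOut∘f
  punchOut∘f-injective {x} {x′} eq = f-injective (punchOut-injective (y≢f x) (y≢f x′) eq)

toRow : ∀ {ℓ} → Fin ℓ → ℕ
toRow x = suc (toℕ x)

toRow≤ : ∀ {ℓ} (x : Fin ℓ) → toRow x ≤ ℓ
toRow≤ = toℕ<n

toRow-injective : ∀ {ℓ} {x y : Fin ℓ} → toRow x ≡ toRow y → x ≡ y
toRow-injective = toℕ-injective ∘ suc-injective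

fromRow : ∀ {ℓ r} → 1 ≤ r → r ≤ ℓ → ∃ λ (x : Fin ℓ) → toRow x ≡ r
fromRow {r = suc r} _ r<ℓ = fromℕ< r<ℓ , cong suc (toℕ-fromℕ< r<ℓ)

injective⇒isPermutationOf : ∀ ℓ (σ : ℕ → ℤ) →
  (∀ i → 1 ≤ i → i ≤ ℓ → Σ ℕ λ m → σ i ≡ + m × 1 ≤ m × m ≤ ℓ) →
  (∀ i j → 1 ≤ i → i ≤ ℓ → 1 ≤ j → j ≤ ℓ → σ i ≡ σ j → i ≡ j) →
  IsPermutationOf ℓ σ
injective⇒isPermutationOf ℓ σ into injective = into , injective , onto
  where
  τ : Fin ℓ → Fin ℓ
  τ x with into (toRow x) (s≤s z≤n) (toRow≤ x)
  ... | _ , _ , 1≤m , m≤ℓ = proj₁ (fromRow 1≤m m≤ℓ)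

  σ≡τ : ∀ x → σ (toRow x) ≡ + toRow (τ x)
  σ≡τ x with into (toRow x) (s≤s z≤n) (toRow≤ x)
  ... | _ , σx≡m , 1≤m , m≤ℓ = trans σx≡m (cong +_ (sym (proj₂ (fromRow 1≤m m≤ℓ))))

  τ-injective : Injective _≡_ _≡_ τ
  τ-injective {x} {y} τx≡τy = toRow-injective
    (injective _ _ (s≤s z≤n) (toRow≤ x) (s≤s z≤n) (toRow≤ y)
      (trans (σ≡τ x) (trans (cong (+_ ∘ toRow) τx≡τy) (sym (σ≡τ y)))))

  onto : ∀ m → 1 ≤ m → m ≤ ℓ → Σ ℕ λ i → 1 ≤ i × i ≤ ℓ × σ i ≡ + m
  onto m 1≤m m≤ℓ =
    let y , y≡m = fromRow 1≤m m≤ℓ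
        x , τx≡y = fin-injective⇒surjective τ-injective y
    in toRow x , s≤s z≤n , toRow≤ x , trans (σ≡τ x) (cong +_ (trans (cong toRow τx≡y) y≡m))

-- (p , q) stands for the diagonal row − col = p − q, written without subtraction.
OnDiagonal : ℕ → ℕ → Cell → Set
OnDiagonal p q (i , j) = i + q ≡ j + p

onDiagonal? : ∀ p q → Decidable (OnDiagonal p q)
onDiagonal? p q (i , j) = i + q ≟ j + p

_≼_ : Cell → Cell → Set
a ≼ b = row a ≤ row b × col b ≤ col a

_⊑_ : Cell → Cell → Set
a ⊑ b = row a ≤ row b × col a ≤ col b

onDiagonal-row-injective : ∀ {p q x y} → OnDiagonal p q x → OnDiagonal p q y →
                           row x ≡ row y → x ≡ y
onDiagonal-row-injective {p} {q} {x} {y} x∈D y∈D rx≡ry = cong₂ _,_ rx≡ry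
  (+-cancelʳ-≡ p (col x) (col y) (trans (sym x∈D) (trans (cong (_+ q) rx≡ry) y∈D)))

onDiagonal-unique : ∀ {p q p′ q′ c} → OnDiagonal p q c → OnDiagonal p′ q′ c →
                    p + q′ ≡ p′ + q
onDiagonal-unique {p} {q} {p′} {q′} {r , j} c∈D c∈D′ = +-cancelˡ-≡ (r + j) _ _ (begin
  (r + j) + (p + q′) ≡⟨ cong (_+ (p + q′)) (+-comm r j) ⟩
  (j + r) + (p + q′) ≡⟨ interchange j r p q′ ⟩
  (j + p) + (r + q′) ≡⟨ cong₂ _+_ (sym c∈D) c∈D′ ⟩
  (r + q) + (j + p′) ≡⟨ interchange r q j p′ ⟩
  (r + j) + (q + p′) ≡⟨ cong (λ n → (r + j) + n) (+-comm q p′) ⟩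
  (r + j) + (p′ + q) ∎)
  where open ≡-Reasoning

onDiag⇔onDiagonal : ∀ p q c → OnDiag ((+ p ℤ.- + q) ℤ.+ + 1) c ⇔ OnDiagonal p q c
onDiag⇔onDiagonal p q (r , j) = mk⇔ to′ from′
  where
  open ≡-Reasoning
  open +-*-Solver

  to′ : (+ r ℤ.- + j) ℤ.+ + 1 ≡ (+ p ℤ.- + q) ℤ.+ + 1 → r + q ≡ j + p
  to′ eq = ℤ.+-injective (begin
    + r ℤ.+ + q
      ≡⟨ solve 3 (λ r j q → r :+ q := ((r :- j) :+ con (+ 1)) :+ ((j :+ q) :- con (+ 1)))
               refl (+ r) (+ j) (+ q) ⟩
    ((+ r ℤ.- + j) ℤ.+ + 1) ℤ.+ ((+ j ℤ.+ + q) ℤ.- + 1)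
      ≡⟨ cong (ℤ._+ ((+ j ℤ.+ + q) ℤ.- + 1)) eq ⟩
    ((+ p ℤ.- + q) ℤ.+ + 1) ℤ.+ ((+ j ℤ.+ + q) ℤ.- + 1)
      ≡⟨ solve 3 (λ p q j → ((p :- q) :+ con (+ 1)) :+ ((j :+ q) :- con (+ 1)) := j :+ p)
               refl (+ p) (+ q) (+ j) ⟩
    + j ℤ.+ + p ∎)

  from′ : r + q ≡ j + p → (+ r ℤ.- + j) ℤ.+ + 1 ≡ (+ p ℤ.- + q) ℤ.+ + 1
  from′ eq = begin
    (+ r ℤ.- + j) ℤ.+ + 1
      ≡⟨ solve 3 (λ r j q → (r :- j) :+ con (+ 1) := ((r :+ q) :- (j :+ q)) :+ con (+ 1))
               refl (+ r) (+ j) (+ q) ⟩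
    ((+ r ℤ.+ + q) ℤ.- (+ j ℤ.+ + q)) ℤ.+ + 1
      ≡⟨ cong (λ n → (+ n ℤ.- (+ j ℤ.+ + q)) ℤ.+ + 1) eq ⟩
    ((+ j ℤ.+ + p) ℤ.- (+ j ℤ.+ + q)) ℤ.+ + 1
      ≡⟨ solve 3 (λ j p q → ((j :+ p) :- (j :+ q)) :+ con (+ 1) := (p :- q) :+ con (+ 1))
               refl (+ j) (+ p) (+ q) ⟩
    (+ p ℤ.- + q) ℤ.+ + 1 ∎

+[r+n]-+n≡+r : ∀ {r n i} → r + n ≡ i → + i ℤ.- + n ≡ + r
+[r+n]-+n≡+r {r} {n} refl = solve 2 (λ r n → (r :+ n) :- n := r) refl (+ r) (+ n)
  where open +-*-Solver

DiagonalBetween : Cell → Cell → ℕ → ℕ → Set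
DiagonalBetween a z p q = row a + q ≤ col a + p × col z + p ≤ row z + q

diagonalBetween? : ∀ a z p q → Dec (DiagonalBetween a z p q)
diagonalBetween? a z p q = (row a + q ≤? col a + p) ×-dec (col z + p ≤? row z + q)

≼⇒diagonal≤ : ∀ {a b p q} → a ≼ b → OnDiagonal p q b → row a + q ≤ col a + p
≼⇒diagonal≤ {a} {b} {p} {q} (ra≤rb , cb≤ca) b∈D = begin
  row a + q ≤⟨ +-monoˡ-≤ q ra≤rb ⟩
  row b + q ≡⟨ b∈D ⟩
  col b + p ≤⟨ +-monoˡ-≤ p cb≤ca ⟩
  col a + p ∎
  where open ≤-Reasoning

≼⇒diagonal≥ : ∀ {a b p q} → a ≼ b → OnDiagonal p q a → col b + p ≤ row b + q
≼⇒diagonal≥ {a} {b} {p} {q} (ra≤rb , cb≤ca) a∈D = begin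
  col b + p ≤⟨ +-monoˡ-≤ p cb≤ca ⟩
  col a + p ≡⟨ a∈D ⟨
  row a + q ≤⟨ +-monoˡ-≤ q ra≤rb ⟩
  row b + q ∎
  where open ≤-Reasoning

on⇒diagonalBetween : ∀ {a z c p q} → a ≼ c → c ≼ z → OnDiagonal p q c →
                     DiagonalBetween a z p q
on⇒diagonalBetween a≼c c≼z c∈D = ≼⇒diagonal≤ a≼c c∈D , ≼⇒diagonal≥ c≼z c∈D

-- Both sides equal [row a − col a ≤ p − q ≤ row z − col z + 1].
diagonalBetween-step : ∀ {a z} p q → a ≼ z →
  indicator (diagonalBetween? a z p q) + indicator (onDiagonal? p (suc q) z) ≡
  indicator (diagonalBetween? a z p (suc q)) + indicator (onDiagonal? p q a)
diagonalBetween-step {a} {z} p q a≼z =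
  trans (sym (indicator-⊎ (diagonalBetween? a z p q) (onDiagonal? p (suc q) z) wide?
                          wide⇔upper disjointUpper))
        (indicator-⊎ (diagonalBetween? a z p (suc q)) (onDiagonal? p q a) wide?
                     wide⇔lower disjointLower)
  where
  Wide = row a + q ≤ col a + p × col z + p ≤ row z + suc q
  wide? = (row a + q ≤? col a + p) ×-dec (col z + p ≤? row z + suc q)

  q≤1+q : ∀ m → m + q ≤ m + suc q
  q≤1+q m = +-monoʳ-≤ m (n≤1+n q)

  wide⇔upper : Wide ⇔ (DiagonalBetween a z p q ⊎ OnDiagonal p (suc q) z)
  wide⇔upper = mk⇔ split join
    where
    split : Wide → DiagonalBetween a z p q ⊎ OnDiagonal p (suc q) z
    split (lower , upper) with m≤n⇒m<n∨m≡n upper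
    ... | inj₁ below = inj₁ (lower , ≤-pred (≤-trans below (≤-reflexive (+-suc (row z) q))))
    ... | inj₂ on    = inj₂ (sym on)
    join : DiagonalBetween a z p q ⊎ OnDiagonal p (suc q) z → Wide
    join (inj₁ (lower , upper)) = lower , ≤-trans upper (q≤1+q (row z))
    join (inj₂ z∈D) =
      ≤-trans (q≤1+q (row a)) (≼⇒diagonal≤ a≼z z∈D) , ≤-reflexive (sym z∈D)

  disjointUpper : ¬ (DiagonalBetween a z p q × OnDiagonal p (suc q) z)
  disjointUpper ((_ , upper) , z∈D) =
    1+n≰n (≤-trans (≤-reflexive (sym (+-suc (row z) q))) (≤-trans (≤-reflexive z∈D) upper))

  wide⇔lower : Wide ⇔ (DiagonalBetween a z p (suc q) ⊎ OnDiagonal p q a)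
  wide⇔lower = mk⇔ split join
    where
    split : Wide → DiagonalBetween a z p (suc q) ⊎ OnDiagonal p q a
    split (lower , upper) with m≤n⇒m<n∨m≡n lower
    ... | inj₁ above = inj₁ (≤-trans (≤-reflexive (+-suc (row a) q)) above , upper)
    ... | inj₂ on    = inj₂ on
    join : DiagonalBetween a z p (suc q) ⊎ OnDiagonal p q a → Wide
    join (inj₁ (lower , upper)) = ≤-trans (q≤1+q (row a)) lower , upper
    join (inj₂ a∈D) = ≤-reflexive a∈D , ≤-trans (≼⇒diagonal≥ a≼z a∈D) (q≤1+q (row z))

  disjointLower : ¬ (DiagonalBetween a z p (suc q) × OnDiagonal p q a)
  disjointLower ((lower , _) , a∈D) =
    1+n≰n (≤-trans (≤-reflexive (sym (+-suc (row a) q))) (≤-trans lower (≤-reflexive (sym a∈D))))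

count-diagonalBetween-step : ∀ {n} (a z : Fin n → Cell) → (∀ i → a i ≼ z i) → ∀ p q →
  count (λ i → diagonalBetween? (a i) (z i) p q) + count (λ i → onDiagonal? p (suc q) (z i)) ≡
  count (λ i → diagonalBetween? (a i) (z i) p (suc q)) + count (λ i → onDiagonal? p q (a i))
count-diagonalBetween-step a z a≼z p q = begin
  sum between + sum onᶻ             ≡⟨ ∑-distrib-+ between onᶻ ⟨
  sum (λ i → between i + onᶻ i)     ≡⟨ sum-cong-≗ (λ i → diagonalBetween-step p q (a≼z i)) ⟩
  sum (λ i → between′ i + onᵃ i)    ≡⟨ ∑-distrib-+ between′ onᵃ ⟩
  sum between′ + sum onᵃ            ∎
  where
  open ≡-Reasoning
  between between′ onᶻ onᵃ : Fin _ → ℕ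
  between  i = indicator (diagonalBetween? (a i) (z i) p q)
  between′ i = indicator (diagonalBetween? (a i) (z i) p (suc q))
  onᶻ      i = indicator (onDiagonal? p (suc q) (z i))
  onᵃ      i = indicator (onDiagonal? p q (a i))

+-difference-cancel : ∀ {a b x y i t} → a + x ≡ b + y → a + t ≡ b + i → x + i ≡ y + t
+-difference-cancel {a} {b} {x} {y} {i} {t} a+x≡b+y a+t≡b+i = +-cancelˡ-≡ a _ _ (begin
  a + (x + i) ≡⟨ +-assoc a x i ⟨
  a + x + i   ≡⟨ cong (_+ i) a+x≡b+y ⟩
  b + y + i   ≡⟨ xy∙z≈xz∙y b y i ⟩
  b + i + y   ≡⟨ cong (_+ y) a+t≡b+i ⟨
  a + t + y   ≡⟨ xy∙z≈x∙zy a t y ⟩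
  a + (y + t) ∎)
  where open ≡-Reasoning

part≤head : ∀ {x xs} → Linked _≥_ (x ∷ xs) → ∀ j → part (x ∷ xs) j ≤ x
part≤head _ zero                                       = z≤n
part≤head _ (suc zero)                                 = ≤-refl
part≤head {xs = []}     _                (suc (suc j)) = z≤n
part≤head {xs = y ∷ ys} (x≥y ∷ linked) (suc (suc j)) = ≤-trans (part≤head linked (suc j)) x≥y

part-antitone : ∀ {λs} → Linked _≥_ λs → ∀ {i j} → 1 ≤ i → i ≤ j →
                part λs j ≤ part λs i
part-antitone {[]}     _      {suc i} {suc j} _ _                   = z≤n
part-antitone {x ∷ xs} linked {suc zero} {j} _ _                    = part≤head linked j
part-antitone {x ∷ xs} linked {suc (suc i)} {suc (suc j)} _ (s≤s i≤j) =
  part-antitone (Linked.tail linked) (s≤s z≤n) i≤j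

part≥1 : ∀ {λs} → All (1 ≤_) λs → ∀ {i} → 1 ≤ i → i ≤ length λs → 1 ≤ part λs i
part≥1 (x≥1 ∷ _)     {suc zero}    _ _         = x≥1
part≥1 (_   ∷ xs≥1) {suc (suc i)} _ (s≤s i≤n) = part≥1 xs≥1 (s≤s z≤n) i≤n

part≥1⇒≤length : ∀ λs i → 1 ≤ part λs i → i ≤ length λs
part≥1⇒≤length (x ∷ xs) (suc zero)    _ = s≤s z≤n
part≥1⇒≤length (x ∷ xs) (suc (suc i)) p = s≤s (part≥1⇒≤length xs (suc i) p)

i-λᵢ-injective : ∀ {λs} → Linked _≥_ λs → ∀ {i j} → 1 ≤ i → 1 ≤ j →
                 i + part λs j ≡ j + part λs i → i ≡ j
i-λᵢ-injective {λs} linked {i} {j} 1≤i 1≤j eq with <-cmp i j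
... | tri< i<j _ _ = contradiction eq (<⇒≢ (+-mono-<-≤ i<j (part-antitone linked 1≤i (<⇒≤ i<j))))
... | tri≈ _ i≡j _ = i≡j
... | tri> _ _ j<i =
  contradiction (sym eq) (<⇒≢ (+-mono-<-≤ j<i (part-antitone linked 1≤j (<⇒≤ j<i))))

module _ {A : Set} (f : A → ℕ) {x : A} {xs : List A} (x∈xs : x ∈ xs) where

  argmin∈ : argmin f x xs ∈ xs
  argmin∈ = argmin-all f x∈xs (All.tabulate id)

  argmin≤ : ∀ {y} → y ∈ xs → f (argmin f x xs) ≤ f y
  argmin≤ = All.lookup (f[argmin]≤f[xs] x xs)

  argmax∈ : argmax f x xs ∈ xs
  argmax∈ = argmax-all f x∈xs (All.tabulate id)

  ≤argmax : ∀ {y} → y ∈ xs → f y ≤ f (argmax f x xs)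
  ≤argmax = All.lookup (f[xs]≤f[argmax] x xs)

module _ {h : List Cell} (skew : IsSkew h) where

  private
    μ = proj₁ skew
    ν = proj₁ (proj₂ skew)
    μ-linked = proj₁ (proj₁ (proj₂ (proj₂ skew)))
    ν-linked = proj₁ (proj₁ (proj₂ (proj₂ (proj₂ skew))))
    h≡μ/ν = proj₂ (proj₂ (proj₂ (proj₂ (proj₂ skew))))

  skew-col≥1 : ∀ {c} → c ∈ h → 1 ≤ col c
  skew-col≥1 {c} c∈h = proj₁ (proj₂ (proj₁ (proj₁ (h≡μ/ν c) c∈h)))

  skew-convex : ∀ {x y c} → x ∈ h → y ∈ h → x ⊑ c → c ⊑ y → c ∈ h
  skew-convex {x} {y} {c} x∈h y∈h (rx≤rc , cx≤cc) (rc≤ry , cc≤cy) =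
    proj₂ (h≡μ/ν c) c∈μ c∉ν
    where
    x∈μ = proj₁ (proj₁ (h≡μ/ν x) x∈h)
    x∉ν = proj₂ (proj₁ (h≡μ/ν x) x∈h)
    y∈μ = proj₁ (proj₁ (h≡μ/ν y) y∈h)
    1≤rc = ≤-trans (proj₁ x∈μ) rx≤rc
    c∈μ : InDiag μ c
    c∈μ = 1≤rc , ≤-trans (proj₁ (proj₂ x∈μ)) cx≤cc ,
          ≤-trans cc≤cy (≤-trans (proj₂ (proj₂ y∈μ)) (part-antitone μ-linked 1≤rc rc≤ry))
    c∉ν : ¬ InDiag ν c
    c∉ν (_ , _ , cc≤ν) = x∉ν (proj₁ x∈μ , proj₁ (proj₂ x∈μ) ,
          ≤-trans cx≤cc (≤-trans cc≤ν (part-antitone ν-linked (proj₁ x∈μ) rx≤rc)))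

  skew-onDiagonal-square : ∀ {p q x y} → x ∈ h → y ∈ h →
    OnDiagonal p q x → OnDiagonal p q y → row x < row y →
    Σ ℕ λ i → Σ ℕ λ j →
      (i , j) ∈ h × (suc i , j) ∈ h × (i , suc j) ∈ h × (suc i , suc j) ∈ h
  skew-onDiagonal-square {p} {q} {x} {y} x∈h y∈h x∈D y∈D rx<ry =
    row x , col x , x∈h ,
    skew-convex x∈h y∈h (n≤1+n _ , ≤-refl) (rx<ry , <⇒≤ cx<cy) ,
    skew-convex x∈h y∈h (≤-refl , n≤1+n _) (<⇒≤ rx<ry , cx<cy) ,
    skew-convex x∈h y∈h (n≤1+n _ , n≤1+n _) (rx<ry , cx<cy)
    where
    cx<cy : col x < col y
    cx<cy = +-cancelʳ-< p (col x) (col y) (subst₂ _<_ x∈D y∈D (+-monoˡ-< q rx<ry))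

  rimHook-onDiagonal-unique : NoSquare h → ∀ {p q x y} → x ∈ h → y ∈ h →
                              OnDiagonal p q x → OnDiagonal p q y → x ≡ y
  rimHook-onDiagonal-unique noSquare {x = x} {y} x∈h y∈h x∈D y∈D with <-cmp (row x) (row y)
  ... | tri< rx<ry _ _ = ⊥-elim (noSquare (skew-onDiagonal-square x∈h y∈h x∈D y∈D rx<ry))
  ... | tri≈ _ rx≡ry _ = onDiagonal-row-injective x∈D y∈D rx≡ry
  ... | tri> _ _ ry<rx = ⊥-elim (noSquare (skew-onDiagonal-square y∈h x∈h y∈D x∈D ry<rx))

  skew-terminal : ∀ {i} → (i , 1) ∈ h → ∃ λ b → IsTerminal h (b , 1)
  skew-terminal {i} i1∈h =
    row lowest , b1∈h , λ d d∈h → ≤argmax row i1∈h d∈h , skew-col≥1 d∈h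
    where
    lowest = argmax row (i , 1) h
    b1∈h = skew-convex i1∈h (argmax∈ row i1∈h) (≤argmax row i1∈h i1∈h , ≤-refl)
                       (≤-refl , skew-col≥1 (argmax∈ row i1∈h))

  skew-initial : ∀ {c} → c ∈ h → ∃ (IsInitial h)
  skew-initial {c} c∈h = (row top , col right) , corner∈h ,
                         λ d d∈h → argmin≤ row c∈h d∈h , ≤argmax col c∈h d∈h
    where
    top = argmin row c h
    right = argmax col c h
    corner∈h = skew-convex (argmin∈ row c∈h) (argmax∈ col c∈h)
                 (≤-refl , ≤argmax col c∈h (argmin∈ row c∈h))
                 (argmin≤ row c∈h (argmax∈ col c∈h) , ≤-refl)

isInitial-unique : ∀ {h c c′} → IsInitial h c → IsInitial h c′ → c ≡ c′
isInitial-unique (c∈h , c≼) (c′∈h , c′≼) =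
  cong₂ _,_ (≤-antisym (proj₁ (c≼ _ c′∈h)) (proj₁ (c′≼ _ c∈h)))
            (≤-antisym (proj₂ (c′≼ _ c∈h)) (proj₂ (c≼ _ c′∈h)))

isTerminal-unique : ∀ {h c c′} → IsTerminal h c → IsTerminal h c′ → c ≡ c′
isTerminal-unique (c∈h , ≼c) (c′∈h , ≼c′) =
  cong₂ _,_ (≤-antisym (proj₁ (≼c′ _ c∈h)) (proj₁ (≼c _ c′∈h)))
            (≤-antisym (proj₂ (≼c _ c′∈h)) (proj₂ (≼c′ _ c∈h)))

adjacent-diagonal-step : ∀ {p q c c′} → Adj c c′ →
                         col c + p < row c + q → col c′ + p ≤ row c′ + q
adjacent-diagonal-step {c = i , j}     (inj₁ (refl , inj₁ refl)) below = below
adjacent-diagonal-step {c = i , suc j} (inj₁ (refl , inj₂ refl)) below = <⇒≤ (<⇒≤ below)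
adjacent-diagonal-step {c = i , j}     (inj₂ (refl , inj₁ refl)) below = m≤n⇒m≤1+n (<⇒≤ below)
adjacent-diagonal-step {c = suc i , j} (inj₂ (refl , inj₂ refl)) below = ≤-pred below

path-meets-diagonal : ∀ {h x y} p q → Path h x y →
                      col x + p ≤ row x + q → row y + q ≤ col y + p →
                      ∃ λ c → c ∈ h × OnDiagonal p q c
path-meets-diagonal p q (here x∈h) x≥D x≤D = _ , x∈h , ≤-antisym x≤D x≥D
path-meets-diagonal p q (step {c} c∈h adj path) c≥D y≤D with onDiagonal? p q c
... | yes c∈D = c , c∈h , c∈D
... | no c∉D  =
  path-meets-diagonal p q path (adjacent-diagonal-step adj (≤∧≢⇒< c≥D (c∉D ∘ sym))) y≤D

module _ {λs : List ℕ} (isPartition : IsPartition λs) (R : SRT λs) where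
  open SRT R

  private
    ℓ = length λs
    Hook = Fin (length hooks)
    H : Hook → List Cell
    H = lookup hooks

  hook-skew : ∀ k → IsSkew (H k)
  hook-skew k = proj₁ (rimHook k)

  hook-connected : ∀ k → Connected (H k)
  hook-connected k = proj₁ (proj₂ (rimHook k))

  hook-noSquare : ∀ k → NoSquare (H k)
  hook-noSquare k = proj₂ (proj₂ (rimHook k))

  terminalRow : Hook → ℕ
  terminalRow k = proj₁ (skew-terminal (hook-skew k) (proj₂ (firstCol k)))

  terminal : Hook → Cell
  terminal k = terminalRow k , 1

  terminal-isTerminal : ∀ k → IsTerminal (H k) (terminal k)
  terminal-isTerminal k = proj₂ (skew-terminal (hook-skew k) (proj₂ (firstCol k)))

  initial : Hook → Cell
  initial k = proj₁ (skew-initial (hook-skew k) (proj₂ (firstCol k)))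

  initial-isInitial : ∀ k → IsInitial (H k) (initial k)
  initial-isInitial k = proj₂ (skew-initial (hook-skew k) (proj₂ (firstCol k)))

  terminal∈ : ∀ k → terminal k ∈ H k
  terminal∈ k = proj₁ (terminal-isTerminal k)

  initial∈ : ∀ k → initial k ∈ H k
  initial∈ k = proj₁ (initial-isInitial k)

  initial≼terminal : ∀ k → initial k ≼ terminal k
  initial≼terminal k = proj₂ (initial-isInitial k) _ (terminal∈ k)

  hook-row-bounds : ∀ {k c} → c ∈ H k → 1 ≤ row c × row c ≤ ℓ
  hook-row-bounds {k} {c} c∈H with inside k c c∈H
  ... | 1≤row , 1≤col , col≤part =
    1≤row , part≥1⇒≤length λs (row c) (≤-trans 1≤col col≤part)

  terminalRow-injective : ∀ {k k′} → terminalRow k ≡ terminalRow k′ → k ≡ k′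
  terminalRow-injective {k} {k′} eq = disjoint k k′ (terminal k) (terminal∈ k)
    (subst (λ b → (b , 1) ∈ H k′) (sym eq) (terminal∈ k′))

  rowStart rowEnd : Fin ℓ → Cell
  rowStart x = toRow x , 1
  rowEnd   x = toRow x , part λs (toRow x)

  rowEnd≼rowStart : ∀ x → rowEnd x ≼ rowStart x
  rowEnd≼rowStart x = ≤-refl , part≥1 (proj₂ isPartition) (s≤s z≤n) (toRow≤ x)

  CellOn : ℕ → ℕ → Fin ℓ → Hook → Set
  CellOn p q x k = Any (λ c → row c ≡ toRow x × OnDiagonal p q c) (H k)

  cellOn? : ∀ p q x k → Dec (CellOn p q x k)
  cellOn? p q x k = any? (λ c → (row c ≟ toRow x) ×-dec onDiagonal? p q c) (H k)

  -- Both sides count the cells of λ on the diagonal (p , q).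
  count-rows≡count-hooks : ∀ p q →
    count (λ x → diagonalBetween? (rowEnd x) (rowStart x) p q) ≡
    count (λ k → diagonalBetween? (initial k) (terminal k) p q)
  count-rows≡count-hooks p q = count-matching _ _ (cellOn? p q)
    row⇒cell cell⇒row (λ _ → cell-unique-hook) hook⇒cell cell⇒hook (λ _ → cell-unique-row)
    where
    row⇒cell : ∀ x → DiagonalBetween (rowEnd x) (rowStart x) p q → ∃ (CellOn p q x)
    row⇒cell x (r+q≤λᵣ+p , p<r+q) = k , lose c∈H (refl , sym (m∸n+n≡m (<⇒≤ p<r+q)))
      where
      r = toRow x
      c = r , r + q ∸ p
      c∈λ : InDiag λs c
      c∈λ = s≤s z≤n , m<n⇒0<n∸m p<r+q ,
            ≤-trans (∸-monoˡ-≤ p r+q≤λᵣ+p) (≤-reflexive (m+n∸n≡m (part λs r) p))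
      k = proj₁ (covers c c∈λ)
      c∈H = proj₂ (covers c c∈λ)

    cell⇒row : ∀ {x k} → CellOn p q x k → DiagonalBetween (rowEnd x) (rowStart x) p q
    cell⇒row {x} {k} cell with find cell
    ... | c , c∈H , refl , c∈D with inside k c c∈H
    ...   | _ , 1≤col , col≤part =
      on⇒diagonalBetween {p = p} {q} (≤-refl , col≤part) (≤-refl , 1≤col) c∈D

    cell-unique-hook : ∀ {x k k′} → CellOn p q x k → CellOn p q x k′ → k ≡ k′
    cell-unique-hook {x} {k} {k′} cell cell′ with find cell | find cell′
    ... | c , c∈H , rc≡r , c∈D | c′ , c′∈H , rc′≡r , c′∈D =
      disjoint k k′ c c∈H (subst (_∈ H k′) c′≡c c′∈H)
      where
      c′≡c = onDiagonal-row-injective c′∈D c∈D (trans rc′≡r (sym rc≡r))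

    hook⇒cell : ∀ k → DiagonalBetween (initial k) (terminal k) p q → ∃ λ x → CellOn p q x k
    hook⇒cell k (initial≤D , D≤terminal) with path-meets-diagonal p q
      (hook-connected k (terminal k) (initial k) (terminal∈ k) (initial∈ k)) D≤terminal initial≤D
    ... | c , c∈H , c∈D with hook-row-bounds c∈H
    ...   | 1≤rc , rc≤ℓ with fromRow 1≤rc rc≤ℓ
    ...     | x , x≡rc = x , lose c∈H (sym x≡rc , c∈D)

    cell⇒hook : ∀ {x k} → CellOn p q x k → DiagonalBetween (initial k) (terminal k) p q
    cell⇒hook {x} {k} cell with find cell
    ... | c , c∈H , _ , c∈D =
      on⇒diagonalBetween (proj₂ (initial-isInitial k) c c∈H)
                         (proj₂ (terminal-isTerminal k) c c∈H) c∈D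

    cell-unique-row : ∀ {k x x′} → CellOn p q x k → CellOn p q x′ k → x ≡ x′
    cell-unique-row {k} cell cell′ with find cell | find cell′
    ... | c , c∈H , rc≡r , c∈D | c′ , c′∈H , rc′≡r , c′∈D =
      toRow-injective (trans (sym rc≡r) (trans (cong row c≡c′) rc′≡r))
      where
      c≡c′ = rimHook-onDiagonal-unique (hook-skew k) (hook-noSquare k) c∈H c′∈H c∈D c′∈D

  -- With d = p − q this reads
  --   [1 ≤ d ≤ ℓ] + #{initial cells on d} = #{i : i − λᵢ = d} + #{hooks with terminal row d}.
  diagonal-balance : ∀ p q →
    count (λ x → onDiagonal? p (suc q) (rowStart x)) + count (λ k → onDiagonal? p q (initial k)) ≡
    count (λ x → onDiagonal? p q (rowEnd x)) + count (λ k → onDiagonal? p (suc q) (terminal k))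
  diagonal-balance p q =
    +-difference-cancel {x = rowStarts} {rowEnds} {initials} {terminals} rows-step
      (subst₂ (λ a b → a + terminals ≡ b + initials)
              (sym (count-rows≡count-hooks p q)) (sym (count-rows≡count-hooks p (suc q))) hooks-step)
    where
    rowStarts = count (λ x → onDiagonal? p (suc q) (rowStart x))
    rowEnds   = count (λ x → onDiagonal? p q (rowEnd x))
    initials  = count (λ k → onDiagonal? p q (initial k))
    terminals = count (λ k → onDiagonal? p (suc q) (terminal k))
    rows-step  = count-diagonalBetween-step rowEnd rowStart rowEnd≼rowStart p q
    hooks-step = count-diagonalBetween-step initial terminal initial≼terminal p q

  -- The two clauses of perm_SRT; in the second, r = i − λᵢ.
  data PermValue (σ : ℕ → ℤ) (i : ℕ) : Set where
    viaHook : ∀ k → OnDiagonal i (part λs i) (initial k) → σ i ≡ + terminalRow k →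
              PermValue σ i
    viaRow  : ∀ r → 1 ≤ r → r ≤ ℓ → r + part λs i ≡ i → (∀ k → terminalRow k ≢ r) →
              σ i ≡ + r → PermValue σ i

  isInitial-onDiag : ∀ {k c p q} → IsInitial (H k) c → OnDiag ((+ p ℤ.- + q) ℤ.+ + 1) c →
                     OnDiagonal p q (initial k)
  isInitial-onDiag {k} {c} {p} {q} c-initial c∈D =
    subst (OnDiagonal p q) (isInitial-unique c-initial (initial-isInitial k))
          (to (onDiag⇔onDiagonal p q c) c∈D)

  noInitial⇒rowWithoutTerminal : ∀ {i} → 1 ≤ i → i ≤ ℓ →
    (∀ k → ¬ OnDiagonal i (part λs i) (initial k)) →
    ∃ λ x → toRow x + part λs i ≡ i × (∀ k → terminalRow k ≢ toRow x)
  noInitial⇒rowWithoutTerminal {i} 1≤i i≤ℓ noInitial =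
    x , suc-injective (trans (sym (+-suc (toRow x) λᵢ)) x∈D) , noTerminal
    where
    λᵢ = part λs i
    rowStarts = count (λ x → onDiagonal? i (suc λᵢ) (rowStart x))
    rowEnds   = count (λ x → onDiagonal? i λᵢ (rowEnd x))
    terminals = count (λ k → onDiagonal? i (suc λᵢ) (terminal k))

    rowEnds≥1 : 1 ≤ rowEnds
    rowEnds≥1 with fromRow 1≤i i≤ℓ
    ... | x , refl = ∃⇒count>0 (λ x → onDiagonal? i λᵢ (rowEnd x)) {x} (+-comm i λᵢ)

    rowStarts≤1 : rowStarts ≤ 1
    rowStarts≤1 = count≤1 (λ x → onDiagonal? i (suc λᵢ) (rowStart x))
      (λ x∈D x′∈D → toRow-injective (+-cancelʳ-≡ (suc λᵢ) _ _ (trans x∈D (sym x′∈D))))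

    rowStarts≡rowEnds+terminals : rowStarts ≡ rowEnds + terminals
    rowStarts≡rowEnds+terminals = begin
      rowStarts                                              ≡⟨ +-identityʳ rowStarts ⟨
      rowStarts + 0                                          ≡⟨ cong (λ n → rowStarts + n) initials≡0 ⟨
      rowStarts + count (λ k → onDiagonal? i λᵢ (initial k)) ≡⟨ diagonal-balance i λᵢ ⟩
      rowEnds + terminals                                    ∎
      where
      open ≡-Reasoning
      initials≡0 = count≡0 (λ k → onDiagonal? i λᵢ (initial k)) noInitial

    terminals≡0 : terminals ≡ 0
    terminals≡0 = n≤0⇒n≡0 (+-cancelˡ-≤ 1 terminals 0 (begin
      1 + terminals       ≤⟨ +-monoˡ-≤ terminals rowEnds≥1 ⟩
      rowEnds + terminals ≡⟨ rowStarts≡rowEnds+terminals ⟨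
      rowStarts           ≤⟨ rowStarts≤1 ⟩
      1                   ∎))
      where open ≤-Reasoning

    rowStart∈D : ∃ λ x → OnDiagonal i (suc λᵢ) (rowStart x)
    rowStart∈D = count>0⇒∃ _ (≤-trans rowEnds≥1
      (≤-trans (m≤m+n rowEnds terminals) (≤-reflexive (sym rowStarts≡rowEnds+terminals))))

    x = proj₁ rowStart∈D
    x∈D = proj₂ rowStart∈D

    noTerminal : ∀ k → terminalRow k ≢ toRow x
    noTerminal k bₖ≡r = contradiction terminals≡0 (>⇒≢ (∃⇒count>0
      (λ k → onDiagonal? i (suc λᵢ) (terminal k)) {k} (trans (cong (_+ suc λᵢ) bₖ≡r) x∈D)))

  isPermSRT⇒permValue : ∀ {σ} → IsPermSRT λs R σ →
                        ∀ {i} → 1 ≤ i → i ≤ ℓ → PermValue σ i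
  isPermSRT⇒permValue isPerm {i} 1≤i i≤ℓ with isPerm i 1≤i i≤ℓ
  ... | inj₂ (k , c , t , c-initial , c∈D , t-terminal , σi≡) =
    viaHook k (isInitial-onDiag c-initial c∈D)
      (trans σi≡ (cong (+_ ∘ row) (isTerminal-unique t-terminal (terminal-isTerminal k))))
  ... | inj₁ (noInitial , σi≡) =
    let x , r+λᵢ≡i , noTerminal = noInitial⇒rowWithoutTerminal 1≤i i≤ℓ
          (λ k k∈D → noInitial (k , initial k , initial-isInitial k ,
                                from (onDiag⇔onDiagonal i (part λs i) (initial k)) k∈D))
    in viaRow (toRow x) (s≤s z≤n) (toRow≤ x) r+λᵢ≡i noTerminal
              (trans σi≡ (+[r+n]-+n≡+r r+λᵢ≡i))

  permValue-bounds : ∀ {σ i} → PermValue σ i → Σ ℕ λ m → σ i ≡ + m × 1 ≤ m × m ≤ ℓ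
  permValue-bounds (viaHook k _ σi≡) = terminalRow k , σi≡ , hook-row-bounds (terminal∈ k)
  permValue-bounds (viaRow r 1≤r r≤ℓ _ _ σi≡) = r , σi≡ , 1≤r , r≤ℓ

  permValue-injective : ∀ {σ i j} → 1 ≤ i → 1 ≤ j → PermValue σ i → PermValue σ j →
                        σ i ≡ σ j → i ≡ j
  permValue-injective 1≤i 1≤j (viaHook k i∈D σi≡) (viaHook k′ j∈D σj≡) σi≡σj
    with terminalRow-injective (ℤ.+-injective (trans (sym σi≡) (trans σi≡σj σj≡)))
  ... | refl = i-λᵢ-injective linked 1≤i 1≤j (onDiagonal-unique {c = initial k} i∈D j∈D)
    where linked = proj₁ isPartition
  permValue-injective 1≤i 1≤j (viaRow r _ _ r+λᵢ≡i _ σi≡) (viaRow _ _ _ r+λⱼ≡j _ σj≡) σi≡σj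
    with ℤ.+-injective (trans (sym σi≡) (trans σi≡σj σj≡))
  -- r + λᵢ ≡ i says that the cell (r , 0) lies on the diagonal of (i , λᵢ).
  ... | refl = i-λᵢ-injective linked 1≤i 1≤j (onDiagonal-unique {c = r , 0} r+λᵢ≡i r+λⱼ≡j)
    where linked = proj₁ isPartition
  permValue-injective _ _ (viaHook k _ σi≡) (viaRow r _ _ _ noTerminal σj≡) σi≡σj =
    contradiction (ℤ.+-injective (trans (sym σi≡) (trans σi≡σj σj≡))) (noTerminal k)
  permValue-injective _ _ (viaRow r _ _ _ noTerminal σi≡) (viaHook k _ σj≡) σi≡σj =
    contradiction (ℤ.+-injective (trans (sym σj≡) (trans (sym σi≡σj) σi≡))) (noTerminal k)

  isPermSRT⇒isPermutationOf : ∀ σ → IsPermSRT λs R σ → IsPermutationOf ℓ σ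
  isPermSRT⇒isPermutationOf σ isPerm = injective⇒isPermutationOf ℓ σ
    (λ i 1≤i i≤ℓ → permValue-bounds (value 1≤i i≤ℓ))
    (λ i j 1≤i i≤ℓ 1≤j j≤ℓ →
       permValue-injective 1≤i 1≤j (value 1≤i i≤ℓ) (value 1≤j j≤ℓ))
    where
    value = isPermSRT⇒permValue isPerm

  permSRT : ℕ → ℤ
  permSRT i with Fin.any? (λ k → onDiagonal? i (part λs i) (initial k))
  ... | yes (k , _) = + terminalRow k
  ... | no _        = + i ℤ.- + part λs i

  permSRT-isPermSRT : IsPermSRT λs R permSRT
  permSRT-isPermSRT i _ _ with Fin.any? (λ k → onDiagonal? i (part λs i) (initial k))
  ... | yes (k , k∈D) = inj₂ (k , initial k , terminal k , initial-isInitial k ,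
    from (onDiag⇔onDiagonal i (part λs i) (initial k)) k∈D , terminal-isTerminal k , refl)
  ... | no noInitial  =
    inj₁ ((λ (k , c , c-initial , c∈D) → noInitial (k , isInitial-onDiag c-initial c∈D)) , refl)

lemma6p3 : (λs : List ℕ) → IsPartition λs → (R : SRT λs) →
    Σ (ℕ → ℤ) (λ σ → IsPermSRT λs R σ)
    × ((σ : ℕ → ℤ) → IsPermSRT λs R σ → IsPermutationOf (length λs) σ)
lemma6p3 λs isPartition R =
  (permSRT isPartition R , permSRT-isPermSRT isPartition R) , isPermSRT⇒isPermutationOf isPartition R
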